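{- Let $0\le\alpha<1$. Let $G_1,G_2$ be digraphs; let $u_1,v_1\in V(G_1)$ with $d^-_{u_1}(G_1)=d^+_{v_1}(G_1)=0$, and $u_2,v_2\in V(G_2)$ with $d^+_{u_2}(G_2)=d^-_{v_2}(G_2)=0$. Let $H$ be obtained from disjoint copies of $G_1,G_2$ by identifying $u_1$ with $u_2$ and $v_1$ with $v_2$. Order the vertices of $G_1$ with $u_1$ first and $v_1$ second, and those of $G_2$ with $u_2$ first and $v_2$ second. Let $A_1=\Lambda(G_1)(\{u_1,v_1\})$, $A_2=\Lambda(G_2)(\{u_2,v_2\})$, $d_1=d^+_{u_1}(G_1)$, $d_2=d^+_{v_2}(G_2)$. Then $$\phi_\alpha(H)=(x-\alpha d_1)(x-\alpha d_2)\det(A_1)\det(A_2)-\det\big(\Lambda(G_1)(v_1|u_1)\big)\det\big(\Lambda(G_2)(u_2|v_2)\big).$$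
   Context: Digraphs are finite and simple. $A_\alpha(G)=\alpha D(G)+(1-\alpha)A(G)$ with $A(G)$ the adjacency matrix and $D(G)$ the diagonal outdegree matrix; $\phi_\alpha(G)=\det(xI-A_\alpha(G))$; $d^\pm_w(G)$ are out/in-degrees. $\Lambda(G)=xI-A_\alpha(G)$. For vertex sets $U,V$, $\Lambda(G)(U|V)$ is the submatrix of $\Lambda(G)$ obtained by deleting the rows of the vertices in $U$ and the columns of the vertices in $V$ (remaining rows and columns kept in the given vertex order); $\Lambda(G)(U)=\Lambda(G)(U|U)$, and $\Lambda(G)(u|v)=\Lambda(G)(\{u\}|\{v\})$. -}

module Defs where

import Data.Nat as N
open import Data.Nat using (ℕ; zero; suc)
open import Data.Fin using (Fin; zero; suc; punchIn; splitAt; _≟_)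
open import Data.Bool using (Bool; true; false; _∨_; if_then_else_)
open import Data.Maybe using (Maybe; just; nothing)
open import Data.Sum using (inj₁; inj₂)
open import Relation.Nullary using (does)
open import Relation.Binary.PropositionalEquality using (_≡_; refl; cong₂)
open import Algebra.Bundles using (CommutativeRing)

record Digraph (n : ℕ) : Set where
  field
    adj      : Fin n → Fin n → Bool
    loopless : ∀ i → adj i i ≡ false
open Digraph public

countℕ : ∀ {n} → (Fin n → Bool) → ℕ
countℕ {zero}  f = 0
countℕ {suc n} f = (if f zero then 1 else 0) N.+ countℕ (λ i → f (suc i))

outdeg : ∀ {n} → Digraph n → Fin n → ℕ
outdeg G i = countℕ (adj G i)

indeg : ∀ {n} → Digraph n → Fin n → ℕ
indeg G j = countℕ (λ i → adj G i j)

-- Vertices of H : Fin (2 N.+ (n1 N.+ n2)).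
-- 0 = u (= u1 = u2), 1 = v (= v1 = v2), then the other n1 vertices of G1
-- (in order), then the other n2 vertices of G2 (in order).
-- In G1 : Fin (2 N.+ n1), vertex 0 = u1, vertex 1 = v1; likewise for G2.
in1 : ∀ {n1 n2} → Fin (2 N.+ (n1 N.+ n2)) → Maybe (Fin (2 N.+ n1))
in1 zero = just zero
in1 (suc zero) = just (suc zero)
in1 {n1} (suc (suc k)) with splitAt n1 k
... | inj₁ i = just (suc (suc i))
... | inj₂ _ = nothing

in2 : ∀ {n1 n2} → Fin (2 N.+ (n1 N.+ n2)) → Maybe (Fin (2 N.+ n2))
in2 zero = just zero
in2 (suc zero) = just (suc zero)
in2 {n1} (suc (suc k)) with splitAt n1 k
... | inj₁ _ = nothing
... | inj₂ j = just (suc (suc j))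

liftAdj : ∀ {m} → (Fin m → Fin m → Bool) → Maybe (Fin m) → Maybe (Fin m) → Bool
liftAdj f (just i) (just j) = f i j
liftAdj f _        _        = false

liftAdj-diag : ∀ {m} (f : Fin m → Fin m → Bool) → (∀ i → f i i ≡ false) →
               ∀ a → liftAdj f a a ≡ false
liftAdj-diag f p (just i) = p i
liftAdj-diag f p nothing  = refl

glue : ∀ {n1 n2} → Digraph (2 N.+ n1) → Digraph (2 N.+ n2) → Digraph (2 N.+ (n1 N.+ n2))
glue {n1} {n2} G1 G2 = record
  { adj = λ a b → liftAdj (adj G1) (in1 {n1} {n2} a) (in1 {n1} {n2} b)
                ∨ liftAdj (adj G2) (in2 {n1} {n2} a) (in2 {n1} {n2} b)
  ; loopless = λ a → cong₂ _∨_ (liftAdj-diag (adj G1) (loopless G1) (in1 {n1} {n2} a))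
                                (liftAdj-diag (adj G2) (loopless G2) (in2 {n1} {n2} a))
  }

module _ {c ℓ} (R : CommutativeRing c ℓ) where
  open CommutativeRing R using (Carrier; _+_; _*_; -_; 0#; 1#)

  fromℕ : ℕ → Carrier
  fromℕ zero    = 0#
  fromℕ (suc n) = 1# + fromℕ n

  fromBool : Bool → Carrier
  fromBool b = if b then 1# else 0#

  sgn : ∀ {n} → Fin n → Carrier
  sgn zero    = 1#
  sgn (suc j) = - sgn j

  Σ : ∀ {n} → (Fin n → Carrier) → Carrier
  Σ {zero}  f = 0#
  Σ {suc n} f = f zero + Σ (λ i → f (suc i))

  det : ∀ {n} → (Fin n → Fin n → Carrier) → Carrier
  det {zero}  M = 1#
  det {suc n} M = Σ (λ j → sgn j * (M zero j * det (λ a b → M (suc a) (punchIn j b))))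

  -- Λ(G) = xI - A_α(G),  A_α = α D + (1 - α) A
  Λ : ∀ {n} → Carrier → Carrier → Digraph n → Fin n → Fin n → Carrier
  Λ α x G i j =
    if does (i ≟ j)
    then x + - (α * fromℕ (outdeg G i))
    else - ((1# + - α) * fromBool (adj G i j))

  φ : ∀ {n} → Carrier → Carrier → Digraph n → Carrier
  φ α x G = det (Λ α x G)

  del : ∀ {n} → (Fin (suc n) → Fin (suc n) → Carrier) → Fin (suc n) → Fin (suc n) →
        Fin n → Fin n → Carrier
  del M r c i j = M (punchIn r i) (punchIn c j)

  del01 : ∀ {n} → (Fin (2 N.+ n) → Fin (2 N.+ n) → Carrier) → Fin n → Fin n → Carrier
  del01 M i j = M (suc (suc i)) (suc (suc j))

{-# OPTIONS --safe #-}
module Submission where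

-- Order the vertices of H as u, v, X₁, X₂ (the other vertices of G₁ and of G₂).  Because
-- d⁻(u₁) = d⁺(v₁) = d⁺(u₂) = d⁻(v₂) = 0, the matrix Λ(H) has the zero pattern
--
--          u   v   X₁  X₂
--     u  [ a   b   r₁  0  ]
--     v  [ c   d   0   r₂ ]
--     X₁ [ 0   s₁  A₁  0  ]
--     X₂ [ s₂  0   0   A₂ ]
--
-- with a = x - α d₁ and d = x - α d₂, as in H the vertex u keeps its out-degree from G₁ and v
-- its out-degree from G₂.  Expand det Λ(H) along the row of u.  Expanding the cofactor of a
-- along the row of v gives d det A₁ det A₂: in every other term either the entry vanishes or
-- the n₂ rows of X₂ are supported on n₂ - 1 columns.  For a column w ∈ {v} ∪ X₁, expanding
-- the cofactor of (u, w) along the row of v and then by a generalised Laplace expansion along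
-- the rows of X₁ factors it as the cofactor of (u, w) in B₁ = Λ(G₁)(v₁|u₁) times
-- det B₂, B₂ = Λ(G₂)(u₂|v₂).  Summing over w reassembles -det B₁ det B₂.

open import Defs
open import Data.Nat using (ℕ)
import Data.Nat as N
import Data.Fin as F
open import Data.Fin using (Fin)
open import Relation.Binary.PropositionalEquality using (_≡_)
open import Algebra.Bundles using (CommutativeRing)

open import Data.Nat using (zero; suc; _≤_; _<_; z≤n; s≤s; s≤s⁻¹)
  renaming (_+_ to _+ℕ_; _*_ to _*ℕ_)
open import Data.Nat.Properties
  using ( ≤-refl; ≤-reflexive; ≤-trans; ≤-<-trans; <-≤-trans; n≤1+n; m≤m+n; m<m+n; n≮n; ≮⇒≥; ≰⇒>
        ; _<?_; _≤?_; +-suc; *-suc; *-zeroʳ; +-monoʳ-<; +-monoʳ-≤; +-monoˡ-≤; +-cancelˡ-<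
        ; m≤n⇒∃[o]m+o≡n )
  renaming ( +-assoc to +ℕ-assoc; +-comm to +ℕ-comm; +-identityʳ to +ℕ-identityʳ
           ; *-identityˡ to *ℕ-identityˡ )
open import Data.Fin using (toℕ; punchIn; _↑ˡ_; _↑ʳ_; splitAt; fromℕ<; _≟_)
open import Data.Fin.Properties
  using (splitAt-↑ˡ; splitAt-↑ʳ; toℕ-↑ˡ; toℕ-↑ʳ; toℕ-fromℕ<; ↑ˡ-injective; ↑ʳ-injective; suc-injective)
open import Data.Fin.Patterns using (0F; 1F)
open import Data.Maybe using (just; nothing)
open import Data.Bool using (Bool; false; if_then_else_)
open import Data.Bool.Properties using (∨-identityʳ)
open import Data.Sum using (_⊎_; inj₁; inj₂)
import Data.Sum as Sum
open import Data.Product using (_,_)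
open import Data.Empty using (⊥-elim)
open import Function using (_∘_)
open import Function.Bundles using (mk⇔)
open import Relation.Nullary using (yes; no; does)
open import Relation.Nullary.Decidable using (dec-false; does-⇔)
import Relation.Binary.PropositionalEquality as ≡
open import Relation.Binary.PropositionalEquality using (_≢_)
import Algebra.Solver.CommutativeMonoid as CommutativeMonoidSolver

punchInℕ : ℕ → ℕ → ℕ
punchInℕ zero    c       = suc c
punchInℕ (suc j) zero    = zero
punchInℕ (suc j) (suc c) = suc (punchInℕ j c)

punchInℕ-< : ∀ j c → c < j → punchInℕ j c ≡ c
punchInℕ-< (suc j) zero    _       = ≡.refl
punchInℕ-< (suc j) (suc c) (s≤s p) = ≡.cong suc (punchInℕ-< j c p)

punchInℕ-≥ : ∀ j c → j ≤ c → punchInℕ j c ≡ suc c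
punchInℕ-≥ zero    c       _       = ≡.refl
punchInℕ-≥ (suc j) (suc c) (s≤s p) = ≡.cong suc (punchInℕ-≥ j c p)

punchInℕ≤1+ : ∀ j c → punchInℕ j c ≤ suc c
punchInℕ≤1+ zero    c       = ≤-refl
punchInℕ≤1+ (suc j) zero    = z≤n
punchInℕ≤1+ (suc j) (suc c) = s≤s (punchInℕ≤1+ j c)

≤punchInℕ : ∀ j c → c ≤ punchInℕ j c
≤punchInℕ zero    c       = n≤1+n c
≤punchInℕ (suc j) zero    = z≤n
≤punchInℕ (suc j) (suc c) = s≤s (≤punchInℕ j c)

punchInℕ<1+ : ∀ j {c n} → c < n → punchInℕ j c < suc n
punchInℕ<1+ j {c} c<n = s≤s (≤-trans (punchInℕ≤1+ j c) c<n)

punchInℕ-+ : ∀ a j c → punchInℕ (a +ℕ j) (a +ℕ c) ≡ a +ℕ punchInℕ j c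
punchInℕ-+ zero    j c = ≡.refl
punchInℕ-+ (suc a) j c = ≡.cong suc (punchInℕ-+ a j c)

toℕ-punchIn : ∀ {n} (i : Fin (suc n)) (j : Fin n) → toℕ (punchIn i j) ≡ punchInℕ (toℕ i) (toℕ j)
toℕ-punchIn F.zero    j         = ≡.refl
toℕ-punchIn (F.suc i) F.zero    = ≡.refl
toℕ-punchIn (F.suc i) (F.suc j) = ≡.cong suc (toℕ-punchIn i j)

-- outside a w c is the c-th natural number not in the window [a, a + w).
outside : ℕ → ℕ → ℕ → ℕ
outside zero    w c       = w +ℕ c
outside (suc a) w zero    = zero
outside (suc a) w (suc c) = suc (outside a w c)

outside-zero : ∀ a c → outside a 0 c ≡ c
outside-zero zero    c       = ≡.refl
outside-zero (suc a) zero    = ≡.refl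
outside-zero (suc a) (suc c) = ≡.cong suc (outside-zero a c)

punchInℕ-outside : ∀ a t w c → t ≤ w → punchInℕ (a +ℕ t) (outside a w c) ≡ outside a (suc w) c
punchInℕ-outside zero    t w c       t≤w = punchInℕ-≥ t (w +ℕ c) (≤-trans t≤w (m≤m+n w c))
punchInℕ-outside (suc a) t w zero    t≤w = ≡.refl
punchInℕ-outside (suc a) t w (suc c) t≤w = ≡.cong suc (punchInℕ-outside a t w c t≤w)

-- Determinants of ℕ-indexed matrices

module Determinant {c ℓ} (R : CommutativeRing c ℓ) where
  open CommutativeRing R hiding (zero)
  open import Relation.Binary.Reasoning.Setoid setoid
  open import Algebra.Properties.Ring ring using (-‿distribˡ-*; -‿distribʳ-*; -‿involutive)
  open CommutativeMonoidSolver *-commutativeMonoid using (solve; _⊕_; _⊜_)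

  -- detℕ n reads only the n × n corner.  Block expansions shift and skip indices, which is
  -- plain arithmetic on ℕ but awkward on Fin.
  Matrix : Set c
  Matrix = ℕ → ℕ → Carrier

  sgnℕ : ℕ → Carrier
  sgnℕ zero    = 1#
  sgnℕ (suc k) = - sgnℕ k

  Σℕ : ℕ → (ℕ → Carrier) → Carrier
  Σℕ zero    f = 0#
  Σℕ (suc n) f = f 0 + Σℕ n (λ i → f (suc i))

  minor : Matrix → ℕ → Matrix
  minor M j r c = M (suc r) (punchInℕ j c)

  detℕ        : ℕ → Matrix → Carrier
  laplaceTerm : ℕ → Matrix → ℕ → Carrier

  detℕ zero    M = 1#
  detℕ (suc n) M = Σℕ (suc n) (laplaceTerm n M)

  laplaceTerm n M j = sgnℕ j * (M 0 j * detℕ n (minor M j))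

  sgnℕ-+ : ∀ a b → sgnℕ (a +ℕ b) ≈ sgnℕ a * sgnℕ b
  sgnℕ-+ zero    b = sym (*-identityˡ _)
  sgnℕ-+ (suc a) b = trans (-‿cong (sgnℕ-+ a b)) (-‿distribˡ-* _ _)

  sgnℕ-square : ∀ a → sgnℕ a * sgnℕ a ≈ 1#
  sgnℕ-square zero    = *-identityˡ 1#
  sgnℕ-square (suc a) = begin
    - sgnℕ a * - sgnℕ a     ≈⟨ -‿distribˡ-* _ _ ⟨
    - (sgnℕ a * - sgnℕ a)   ≈⟨ -‿cong (-‿distribʳ-* _ _) ⟨
    - - (sgnℕ a * sgnℕ a)   ≈⟨ -‿involutive _ ⟩
    sgnℕ a * sgnℕ a         ≈⟨ sgnℕ-square a ⟩
    1#                      ∎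

  sgnℕ-+-*-sgnℕ : ∀ a b → sgnℕ (a +ℕ b) * sgnℕ a ≈ sgnℕ b
  sgnℕ-+-*-sgnℕ a b = begin
    sgnℕ (a +ℕ b) * sgnℕ a      ≈⟨ *-cong (sgnℕ-+ a b) refl ⟩
    sgnℕ a * sgnℕ b * sgnℕ a    ≈⟨ solve 2 (λ x y → (x ⊕ y) ⊕ x ⊜ (x ⊕ x) ⊕ y) refl (sgnℕ a) (sgnℕ b) ⟩
    sgnℕ a * sgnℕ a * sgnℕ b    ≈⟨ *-cong (sgnℕ-square a) refl ⟩
    1# * sgnℕ b                 ≈⟨ *-identityˡ _ ⟩
    sgnℕ b                      ∎

  Σℕ-cong : ∀ n {f g : ℕ → Carrier} → (∀ i → i < n → f i ≈ g i) → Σℕ n f ≈ Σℕ n g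
  Σℕ-cong zero    h = refl
  Σℕ-cong (suc n) h = +-cong (h 0 (s≤s z≤n)) (Σℕ-cong n (λ i i<n → h (suc i) (s≤s i<n)))

  Σℕ-zero : ∀ n {f : ℕ → Carrier} → (∀ i → i < n → f i ≈ 0#) → Σℕ n f ≈ 0#
  Σℕ-zero zero    h = refl
  Σℕ-zero (suc n) h =
    trans (+-cong (h 0 (s≤s z≤n)) (Σℕ-zero n (λ i i<n → h (suc i) (s≤s i<n)))) (+-identityˡ 0#)

  Σℕ-split : ∀ m n f → Σℕ (m +ℕ n) f ≈ Σℕ m f + Σℕ n (λ i → f (m +ℕ i))
  Σℕ-split zero    n f = sym (+-identityˡ _)
  Σℕ-split (suc m) n f = trans (+-cong refl (Σℕ-split m n (λ i → f (suc i)))) (sym (+-assoc _ _ _))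

  Σℕ-*ˡ : ∀ n k f → Σℕ n (λ i → k * f i) ≈ k * Σℕ n f
  Σℕ-*ˡ zero    k f = sym (zeroʳ k)
  Σℕ-*ˡ (suc n) k f = trans (+-cong refl (Σℕ-*ˡ n k (λ i → f (suc i)))) (sym (distribˡ k _ _))

  Σℕ-*ʳ : ∀ n k f → Σℕ n (λ i → f i * k) ≈ Σℕ n f * k
  Σℕ-*ʳ zero    k f = sym (zeroˡ k)
  Σℕ-*ʳ (suc n) k f = trans (+-cong refl (Σℕ-*ʳ n k (λ i → f (suc i)))) (sym (distribʳ k _ _))

  Σℕ-window : ∀ n a w f → a +ℕ w ≤ n → (∀ j → j < n → j < a ⊎ a +ℕ w ≤ j → f j ≈ 0#) →
              Σℕ n f ≈ Σℕ w (λ t → f (a +ℕ t))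
  Σℕ-window n       zero    zero    f _        h = Σℕ-zero n (λ j j<n → h j j<n (inj₂ z≤n))
  Σℕ-window (suc n) zero    (suc w) f (s≤s le) h = +-cong refl
    (Σℕ-window n zero w (λ i → f (suc i)) le (λ j j<n o → h (suc j) (s≤s j<n) (Sum.map (λ ()) s≤s o)))
  Σℕ-window (suc n) (suc a) w       f (s≤s le) h = begin
    f 0 + Σℕ n (λ i → f (suc i)) ≈⟨ +-cong (h 0 (s≤s z≤n) (inj₁ (s≤s z≤n))) refl ⟩
    0# + Σℕ n (λ i → f (suc i))  ≈⟨ +-identityˡ _ ⟩
    Σℕ n (λ i → f (suc i))       ≈⟨ Σℕ-window n a w (λ i → f (suc i)) le
                                      (λ j j<n o → h (suc j) (s≤s j<n) (Sum.map s≤s s≤s o)) ⟩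
    Σℕ w (λ t → f (suc a +ℕ t))  ∎

  detℕ-cong : ∀ n {M M′ : Matrix} → (∀ r c → r < n → c < n → M r c ≈ M′ r c) → detℕ n M ≈ detℕ n M′
  detℕ-cong zero    h = refl
  detℕ-cong (suc n) {M} {M′} h = Σℕ-cong (suc n) {laplaceTerm n M} {laplaceTerm n M′} λ j j<1+n →
    *-cong refl (*-cong (h 0 j (s≤s z≤n) j<1+n)
      (detℕ-cong n (λ r c r<n c<n → h (suc r) (punchInℕ j c) (s≤s r<n) (punchInℕ<1+ j c<n))))

  laplaceTerm-zeroEntry : ∀ n M j → M 0 j ≈ 0# → laplaceTerm n M j ≈ 0#
  laplaceTerm-zeroEntry n M j e = trans (*-cong refl (trans (*-cong e refl) (zeroˡ _))) (zeroʳ _)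

  laplaceTerm-zeroMinor : ∀ n M j → detℕ n (minor M j) ≈ 0# → laplaceTerm n M j ≈ 0#
  laplaceTerm-zeroMinor n M j e = trans (*-cong refl (trans (*-cong refl e) (zeroʳ _))) (zeroʳ _)

  detℕ-zeroColumn : ∀ n M → (∀ r → r < suc n → M r 0 ≈ 0#) → detℕ (suc n) M ≈ 0#
  detℕ-zeroColumn zero    M h = trans (+-identityʳ _) (laplaceTerm-zeroEntry 0 M 0 (h 0 (s≤s z≤n)))
  detℕ-zeroColumn (suc n) M h = Σℕ-zero (suc (suc n)) {laplaceTerm (suc n) M} λ where
    zero    _ → laplaceTerm-zeroEntry (suc n) M 0 (h 0 (s≤s z≤n))
    (suc j) _ → laplaceTerm-zeroMinor (suc n) M (suc j)
                  (detℕ-zeroColumn n (minor M (suc j)) (λ r r<1+n → h (suc r) (s≤s r<1+n)))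

  TopRowsWithin : ℕ → ℕ → ℕ → ℕ → Matrix → Set ℓ
  TopRowsWithin k n a b M = ∀ r c → r < k → c < n → c < a ⊎ b ≤ c → M r c ≈ 0#

  BottomRowsOff : ℕ → ℕ → ℕ → ℕ → Matrix → Set ℓ
  BottomRowsOff k n a b M = ∀ r c → k ≤ r → r < n → a ≤ c → c < b → M r c ≈ 0#

  minor-TopRowsWithin : ∀ {k n a b M} j → a ≤ j → j ≤ b →
                        TopRowsWithin (suc k) (suc n) a (suc b) M → TopRowsWithin k n a b (minor M j)
  minor-TopRowsWithin j a≤j j≤b top r c r<k c<n (inj₁ c<a) =
    top (suc r) _ (s≤s r<k) (punchInℕ<1+ j c<n)
      (inj₁ (≡.subst (_< _) (≡.sym (punchInℕ-< j c (<-≤-trans c<a a≤j))) c<a))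
  minor-TopRowsWithin j a≤j j≤b top r c r<k c<n (inj₂ b≤c) =
    top (suc r) _ (s≤s r<k) (punchInℕ<1+ j c<n)
      (inj₂ (≡.subst (_ ≤_) (≡.sym (punchInℕ-≥ j c (≤-trans j≤b b≤c))) (s≤s b≤c)))

  minor-BottomRowsOff : ∀ {k n a b M} j → BottomRowsOff (suc k) (suc n) a (suc b) M →
                        BottomRowsOff k n a b (minor M j)
  minor-BottomRowsOff j bottom r c k≤r r<n a≤c c<b =
    bottom (suc r) (punchInℕ j c) (s≤s k≤r) (s≤s r<n) (≤-trans a≤c (≤punchInℕ j c))
      (s≤s (≤-trans (punchInℕ≤1+ j c) c<b))

  bottomRowsOff⇒detℕ≈0 : ∀ k n M → k < n → BottomRowsOff k n 0 (suc k) M → detℕ n M ≈ 0#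
  bottomRowsOff⇒detℕ≈0 zero    (suc n) M _         bottom =
    detℕ-zeroColumn n M (λ r r<1+n → bottom r 0 z≤n r<1+n z≤n (s≤s z≤n))
  bottomRowsOff⇒detℕ≈0 (suc k) (suc n) M (s≤s k<n) bottom = Σℕ-zero (suc n) {laplaceTerm n M} λ j _ →
    laplaceTerm-zeroMinor n M j (bottomRowsOff⇒detℕ≈0 k n (minor M j) k<n (minor-BottomRowsOff j bottom))

  topRowsWithin⇒detℕ≈0 : ∀ k a b n M → a ≤ b → b < a +ℕ k → k ≤ n → TopRowsWithin k n a b M →
                         detℕ n M ≈ 0#
  topRowsWithin⇒detℕ≈0 zero    a b n       M a≤b b<a+0   _         _   =
    ⊥-elim (n≮n a (≤-<-trans a≤b (≤-trans b<a+0 (≤-reflexive (+ℕ-identityʳ a)))))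
  topRowsWithin⇒detℕ≈0 (suc k) a b (suc n) M a≤b b<a+1+k (s≤s k≤n) top =
    Σℕ-zero (suc n) {laplaceTerm n M} term
    where
    term : ∀ j → j < suc n → laplaceTerm n M j ≈ 0#
    term j j<1+n with j <? a | b ≤? j
    ... | yes j<a | _       = laplaceTerm-zeroEntry n M j (top 0 j (s≤s z≤n) j<1+n (inj₁ j<a))
    ... | no _    | yes b≤j = laplaceTerm-zeroEntry n M j (top 0 j (s≤s z≤n) j<1+n (inj₂ b≤j))
    ... | no j≮a  | no b≰j  =
      laplaceTerm-zeroMinor n M j (minorVanishes b (≮⇒≥ j≮a) (≰⇒> b≰j) b<a+1+k top)
      where
      minorVanishes : ∀ b → a ≤ j → j < b → b < a +ℕ suc k → TopRowsWithin (suc k) (suc n) a b M →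
                      detℕ n (minor M j) ≈ 0#
      minorVanishes (suc b) a≤j (s≤s j≤b) b<a+1+k top =
        topRowsWithin⇒detℕ≈0 k a b n (minor M j) (≤-trans a≤j j≤b)
          (s≤s⁻¹ (≡.subst (suc (suc b) ≤_) (+-suc a k) b<a+1+k)) k≤n (minor-TopRowsWithin j a≤j j≤b top)

  detℕ-window : ∀ w m a M → a ≤ m →
                TopRowsWithin w (w +ℕ m) a (a +ℕ w) M → BottomRowsOff w (w +ℕ m) a (a +ℕ w) M →
                detℕ (w +ℕ m) M ≈
                sgnℕ (a *ℕ w) * detℕ w (λ r c → M r (a +ℕ c)) * detℕ m (λ r c → M (w +ℕ r) (outside a w c))
  detℕ-window zero m a M _ _ _ = begin
    detℕ m M
      ≈⟨ detℕ-cong m (λ r c _ _ → reflexive (≡.cong (M r) (≡.sym (outside-zero a c)))) ⟩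
    detℕ m (λ r c → M r (outside a 0 c))
      ≈⟨ *-identityˡ _ ⟨
    1# * detℕ m (λ r c → M r (outside a 0 c))
      ≈⟨ *-cong (trans (*-identityʳ _) (reflexive (≡.cong sgnℕ (*-zeroʳ a)))) refl ⟨
    sgnℕ (a *ℕ 0) * 1# * detℕ m (λ r c → M r (outside a 0 c)) ∎
  detℕ-window (suc w) m a M a≤m top bottom = begin
    Σℕ (suc n) (laplaceTerm n M)
      ≈⟨ Σℕ-window (suc n) a (suc w) _ window≤1+n
           (λ j j<1+n o → laplaceTerm-zeroEntry n M j (top 0 j (s≤s z≤n) j<1+n o)) ⟩
    Σℕ (suc w) (λ t → laplaceTerm n M (a +ℕ t))
      ≈⟨ Σℕ-cong (suc w) term ⟩
    Σℕ (suc w) (λ t → s * laplaceTerm w W t * D)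
      ≈⟨ trans (Σℕ-*ʳ (suc w) D (λ t → s * laplaceTerm w W t))
               (*-cong (Σℕ-*ˡ (suc w) s (laplaceTerm w W)) refl) ⟩
    s * detℕ (suc w) W * D
      ≈⟨ *-cong (*-cong (trans (reflexive (≡.cong sgnℕ (*-suc a w))) (sgnℕ-+ a (a *ℕ w))) refl) refl ⟨
    sgnℕ (a *ℕ suc w) * detℕ (suc w) W * D ∎
    where
    n = w +ℕ m
    W : Matrix
    W r c = M r (a +ℕ c)
    D = detℕ m (λ r c → M (suc w +ℕ r) (outside a (suc w) c))
    s = sgnℕ a * sgnℕ (a *ℕ w)
    top′ : TopRowsWithin (suc w) (suc n) a (suc (a +ℕ w)) M
    top′ = ≡.subst (λ b → TopRowsWithin (suc w) (suc n) a b M) (+-suc a w) top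
    bottom′ : BottomRowsOff (suc w) (suc n) a (suc (a +ℕ w)) M
    bottom′ = ≡.subst (λ b → BottomRowsOff (suc w) (suc n) a b M) (+-suc a w) bottom
    window≤1+n : a +ℕ suc w ≤ suc n
    window≤1+n = ≡.subst (_≤ suc n) (≡.sym (+-suc a w))
                   (s≤s (≡.subst (a +ℕ w ≤_) (+ℕ-comm m w) (+-monoˡ-≤ w a≤m)))
    term : ∀ t → t < suc w → laplaceTerm n M (a +ℕ t) ≈ s * laplaceTerm w W t * D
    term t (s≤s t≤w) = begin
      sgnℕ (a +ℕ t) * (M 0 (a +ℕ t) * detℕ n (minor M (a +ℕ t)))
        ≈⟨ *-cong (sgnℕ-+ a t) (*-cong refl (trans minor-window (*-cong (*-cong refl minorW) minorD))) ⟩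
      (sgnℕ a * sgnℕ t) * (M 0 (a +ℕ t) * ((sgnℕ (a *ℕ w) * detℕ w (minor W t)) * D))
        ≈⟨ solve 6 (λ x y e f g h → (x ⊕ y) ⊕ (e ⊕ ((f ⊕ g) ⊕ h)) ⊜ ((x ⊕ f) ⊕ (y ⊕ (e ⊕ g))) ⊕ h)
                   refl _ _ _ _ _ _ ⟩
      s * laplaceTerm w W t * D ∎
      where
      minor-window = detℕ-window w m a (minor M (a +ℕ t)) a≤m
                       (minor-TopRowsWithin (a +ℕ t) (m≤m+n a t) (+-monoʳ-≤ a t≤w) top′)
                       (minor-BottomRowsOff (a +ℕ t) bottom′)
      minorW : detℕ w (λ r c → minor M (a +ℕ t) r (a +ℕ c)) ≈ detℕ w (minor W t)
      minorW = detℕ-cong w (λ r c _ _ → reflexive (≡.cong (M (suc r)) (punchInℕ-+ a t c)))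
      minorD : detℕ m (λ r c → minor M (a +ℕ t) (w +ℕ r) (outside a w c)) ≈ D
      minorD = detℕ-cong m (λ r c _ _ →
                 reflexive (≡.cong (M (suc w +ℕ r)) (punchInℕ-outside a t w c t≤w)))

  extend : ∀ {n} → (Fin n → Carrier) → ℕ → Carrier
  extend {zero}  f _       = 0#
  extend {suc n} f zero    = f F.zero
  extend {suc n} f (suc k) = extend (λ i → f (F.suc i)) k

  extend-toℕ : ∀ {n} (f : Fin n → Carrier) i → extend f (toℕ i) ≡ f i
  extend-toℕ f F.zero    = ≡.refl
  extend-toℕ f (F.suc i) = extend-toℕ (λ j → f (F.suc j)) i

  toMatrix : ∀ {n} → (Fin n → Fin n → Carrier) → Matrix
  toMatrix M r c = extend (λ i → extend (M i) c) r

  toMatrix-toℕ : ∀ {n} (M : Fin n → Fin n → Carrier) i j → toMatrix M (toℕ i) (toℕ j) ≡ M i j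
  toMatrix-toℕ M i j = ≡.trans (extend-toℕ (λ i → extend (M i) (toℕ j)) i) (extend-toℕ (M i) j)

  sgn≡sgnℕ : ∀ {n} (j : Fin n) → sgn R j ≡ sgnℕ (toℕ j)
  sgn≡sgnℕ F.zero    = ≡.refl
  sgn≡sgnℕ (F.suc j) = ≡.cong -_ (sgn≡sgnℕ j)

  Σ≈Σℕ : ∀ {n} (f : Fin n → Carrier) (g : ℕ → Carrier) → (∀ i → f i ≈ g (toℕ i)) → Σ R f ≈ Σℕ n g
  Σ≈Σℕ {zero}  f g h = refl
  Σ≈Σℕ {suc n} f g h = +-cong (h F.zero) (Σ≈Σℕ (f ∘ F.suc) (g ∘ suc) (h ∘ F.suc))

  det≈detℕ : ∀ {n} (M : Fin n → Fin n → Carrier) (N : Matrix) → (∀ i j → M i j ≈ N (toℕ i) (toℕ j)) →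
             det R M ≈ detℕ n N
  det≈detℕ {zero}  M N h = refl
  det≈detℕ {suc n} M N h = Σ≈Σℕ _ (laplaceTerm n N) λ j →
    *-cong (reflexive (sgn≡sgnℕ j)) (*-cong (h F.zero j)
      (det≈detℕ _ (minor N (toℕ j)) λ a b →
         trans (h (F.suc a) (punchIn j b)) (reflexive (≡.cong (N (suc (toℕ a))) (toℕ-punchIn j b)))))

  det≈detℕ-toMatrix : ∀ {m n} (M : Fin m → Fin m → Carrier) (f g : Fin n → Fin m) (f′ g′ : ℕ → ℕ) →
                      (∀ i → toℕ (f i) ≡ f′ (toℕ i)) → (∀ j → toℕ (g j) ≡ g′ (toℕ j)) →
                      det R (λ i j → M (f i) (g j)) ≈ detℕ n (λ r c → toMatrix M (f′ r) (g′ c))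
  det≈detℕ-toMatrix M f g f′ g′ hf hg = det≈detℕ _ _ λ i j →
    reflexive (≡.trans (≡.sym (toMatrix-toℕ M (f i) (g j))) (≡.cong₂ (toMatrix M) (hf i) (hg j)))

  det-cong : ∀ {m} {M M′ : Fin m → Fin m → Carrier} → (∀ i j → M i j ≈ M′ i j) → det R M ≈ det R M′
  det-cong {m} {M} {M′} h = begin
    det R M                ≈⟨ det≈detℕ M (toMatrix M′) (λ i j → trans (h i j) (toMatrix≈ i j)) ⟩
    detℕ m (toMatrix M′)   ≈⟨ det≈detℕ M′ (toMatrix M′) toMatrix≈ ⟨
    det R M′               ∎
    where
    toMatrix≈ : ∀ i j → M′ i j ≈ toMatrix M′ (toℕ i) (toℕ j)
    toMatrix≈ i j = reflexive (≡.sym (toMatrix-toℕ M′ i j))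

  -- The determinant of a glued matrix

  -- Index 0 stands for u, 1 for v, 2 + t (t < n1) for the vertices X₁ of G₁ other than u, v and
  -- 2 + (n1 + s) (s < n2) for those X₂ of G₂.  B₁ keeps the rows u, X₁ and the columns v, X₁;
  -- B₂ keeps the rows v, X₂ and the columns u, X₂.
  module GluedMatrix (n1 n2 : ℕ) (N : Matrix)
    (u-X₂  : ∀ s → s < n2 → N 0 (2 +ℕ (n1 +ℕ s)) ≈ 0#)
    (v-X₁  : ∀ t → t < n1 → N 1 (2 +ℕ t) ≈ 0#)
    (X₁-u  : ∀ t → t < n1 → N (2 +ℕ t) 0 ≈ 0#)
    (X₁-X₂ : ∀ t s → t < n1 → s < n2 → N (2 +ℕ t) (2 +ℕ (n1 +ℕ s)) ≈ 0#)
    (X₂-v  : ∀ s → s < n2 → N (2 +ℕ (n1 +ℕ s)) 1 ≈ 0#)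
    (X₂-X₁ : ∀ s t → s < n2 → t < n1 → N (2 +ℕ (n1 +ℕ s)) (2 +ℕ t) ≈ 0#)
    where

    n : ℕ
    n = n1 +ℕ n2

    A₁ A₂ B₁ B₂ : Matrix
    A₁ r c = N (2 +ℕ r) (2 +ℕ c)
    A₂ r c = N (2 +ℕ (n1 +ℕ r)) (2 +ℕ (n1 +ℕ c))
    B₁ r c = N (punchInℕ 1 r) (suc c)
    B₂ r c = N (outside 2 n1 (suc r)) (outside 2 n1 (punchInℕ 1 c))

    private
      u-X₂≈0 : ∀ c → 2 +ℕ n1 ≤ c → c < 2 +ℕ n → N 0 c ≈ 0#
      u-X₂≈0 c 2+n1≤c c<2+n with s , ≡.refl ← m≤n⇒∃[o]m+o≡n 2+n1≤c =
        u-X₂ s (+-cancelˡ-< (2 +ℕ n1) s n2 c<2+n)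

      v-X₁≈0 : ∀ c → 2 ≤ c → c < 2 +ℕ n1 → N 1 c ≈ 0#
      v-X₁≈0 (suc zero)    (s≤s ()) _
      v-X₁≈0 (suc (suc t)) _        (s≤s (s≤s t<n1)) = v-X₁ t t<n1

      X₁-uX₂≈0 : ∀ r c → r < n1 → c < 2 +ℕ n → c ≡ 0 ⊎ 2 +ℕ n1 ≤ c → N (2 +ℕ r) c ≈ 0#
      X₁-uX₂≈0 r c r<n1 _     (inj₁ ≡.refl) = X₁-u r r<n1
      X₁-uX₂≈0 r c r<n1 c<2+n (inj₂ 2+n1≤c) with s , ≡.refl ← m≤n⇒∃[o]m+o≡n 2+n1≤c =
        X₁-X₂ r s r<n1 (+-cancelˡ-< (2 +ℕ n1) s n2 c<2+n)

      X₂-vX₁≈0 : ∀ r c → n1 ≤ r → r < n → 1 ≤ c → c < 2 +ℕ n1 → N (2 +ℕ r) c ≈ 0#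
      X₂-vX₁≈0 r c n1≤r r<n 1≤c c<2+n1 with s , ≡.refl ← m≤n⇒∃[o]m+o≡n n1≤r = row c 1≤c c<2+n1
        where
        s<n2 = +-cancelˡ-< n1 s n2 r<n
        row : ∀ c → 1 ≤ c → c < 2 +ℕ n1 → N (2 +ℕ (n1 +ℕ s)) c ≈ 0#
        row (suc zero)    _ _                = X₂-v s s<n2
        row (suc (suc t)) _ (s≤s (s≤s t<n1)) = X₂-X₁ s t s<n2 t<n1

      column-≡ : ∀ {r c c′ x} → c ≡ c′ → N r c′ ≈ x → N r c ≈ x
      column-≡ ≡.refl e = e

    detℕ-innerBlock : detℕ n (λ r c → N (2 +ℕ r) (2 +ℕ c)) ≈ detℕ n1 A₁ * detℕ n2 A₂
    detℕ-innerBlock = trans (detℕ-window n1 n2 0 _ z≤n top bottom) (*-cong (*-identityˡ _) refl)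
      where
      top : TopRowsWithin n1 n 0 n1 (λ r c → N (2 +ℕ r) (2 +ℕ c))
      top r c r<n1 c<n (inj₂ n1≤c) =
        X₁-uX₂≈0 r (2 +ℕ c) r<n1 (s≤s (s≤s c<n)) (inj₂ (s≤s (s≤s n1≤c)))
      bottom : BottomRowsOff n1 n 0 n1 (λ r c → N (2 +ℕ r) (2 +ℕ c))
      bottom r c n1≤r r<n _ c<n1 = X₂-vX₁≈0 r (2 +ℕ c) n1≤r r<n (s≤s z≤n) (s≤s (s≤s c<n1))

    detℕ-minor₀ : detℕ (suc n) (minor N 0) ≈ N 1 1 * (detℕ n1 A₁ * detℕ n2 A₂)
    detℕ-minor₀ = begin
      laplaceTerm n D 0 + Σℕ n (λ t → laplaceTerm n D (suc t))
        ≈⟨ +-cong (trans (*-identityˡ _) (*-cong refl detℕ-innerBlock))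
                  (trans (Σℕ-split n1 n2 _) (+-cong (Σℕ-zero n1 X₁-term≈0) (Σℕ-zero n2 X₂-term≈0))) ⟩
      N 1 1 * (detℕ n1 A₁ * detℕ n2 A₂) + (0# + 0#)
        ≈⟨ trans (+-cong refl (+-identityʳ 0#)) (+-identityʳ _) ⟩
      N 1 1 * (detℕ n1 A₁ * detℕ n2 A₂) ∎
      where
      D = minor N 0
      X₁-term≈0 : ∀ t → t < n1 → laplaceTerm n D (suc t) ≈ 0#
      X₁-term≈0 t t<n1 =
        laplaceTerm-zeroEntry n D (suc t) (v-X₁≈0 (2 +ℕ t) (s≤s (s≤s z≤n)) (s≤s (s≤s t<n1)))
      X₂-term≈0 : ∀ s → s < n2 → laplaceTerm n D (suc (n1 +ℕ s)) ≈ 0#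
      X₂-term≈0 s s<n2 = laplaceTerm-zeroMinor n D _
        (bottomRowsOff⇒detℕ≈0 n1 n _ (m<m+n n1 (≤-trans (s≤s z≤n) s<n2)) bottom)
        where
        bottom : BottomRowsOff n1 n 0 (suc n1) (minor D (suc (n1 +ℕ s)))
        bottom r c n1≤r r<n _ c<1+n1 =
          column-≡ (≡.cong suc (punchInℕ-< (suc (n1 +ℕ s)) c (≤-trans c<1+n1 (s≤s (m≤m+n n1 s)))))
            (X₂-vX₁≈0 r (suc c) n1≤r r<n (s≤s z≤n) (s≤s c<1+n1))

    minorSuc-middleTerm≈0 : ∀ j t → j ≤ n1 → t < n1 → laplaceTerm n (minor N (suc j)) (suc t) ≈ 0#
    minorSuc-middleTerm≈0 zero    t       _      t<n1 =
      laplaceTerm-zeroEntry n (minor N 1) (suc t) (v-X₁≈0 (2 +ℕ t) (s≤s (s≤s z≤n)) (s≤s (s≤s t<n1)))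
    minorSuc-middleTerm≈0 (suc j) (suc t) _      t<n1 =
      laplaceTerm-zeroEntry n (minor N (2 +ℕ j)) (2 +ℕ t)
        (v-X₁≈0 _ (s≤s (s≤s z≤n)) (s≤s (s≤s (≤-<-trans (punchInℕ≤1+ j t) t<n1))))
    minorSuc-middleTerm≈0 (suc j) zero    1+j≤n1 _    =
      laplaceTerm-zeroMinor n (minor N (2 +ℕ j)) 1
        (topRowsWithin⇒detℕ≈0 n1 1 n1 n _ (≤-trans (s≤s z≤n) 1+j≤n1) ≤-refl (m≤m+n n1 n2) top)
      where
      top : TopRowsWithin n1 n 1 n1 (minor (minor N (2 +ℕ j)) 1)
      top r zero    r<n1 _   _            = X₁-uX₂≈0 r 0 r<n1 (s≤s z≤n) (inj₁ ≡.refl)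
      top r (suc c) r<n1 c<n (inj₁ (s≤s ()))
      top r (suc c) r<n1 c<n (inj₂ n1≤c) =
        column-≡ (≡.cong suc (punchInℕ-≥ (suc j) (suc c) (≤-trans 1+j≤n1 n1≤c)))
          (X₁-uX₂≈0 r (2 +ℕ suc c) r<n1 (s≤s (s≤s c<n)) (inj₂ (s≤s (s≤s n1≤c))))

    detℕ-minorSuc : ∀ j → j ≤ n1 →
                    detℕ (suc n) (minor N (suc j)) ≈ detℕ n1 (minor B₁ j) * detℕ (suc n2) B₂
    detℕ-minorSuc j j≤n1 = begin
      laplaceTerm n D 0 + Σℕ n (λ t → laplaceTerm n D (suc t))
        ≈⟨ +-cong (trans (*-identityˡ _) (*-cong refl firstColumn))
                  (trans (Σℕ-split n1 n2 _)
                         (+-cong (Σℕ-zero n1 (λ t → minorSuc-middleTerm≈0 j t j≤n1))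
                                 (Σℕ-cong n2 X₂-term))) ⟩
      N 1 0 * (C * detℕ n2 A₂) + (0# + Σℕ n2 (λ s → C * laplaceTerm n2 B₂ (suc s)))
        ≈⟨ +-cong (solve 3 (λ x y z → x ⊕ (y ⊕ z) ⊜ y ⊕ (x ⊕ z)) refl _ _ _)
                  (trans (+-identityˡ _) (Σℕ-*ˡ n2 C (λ s → laplaceTerm n2 B₂ (suc s)))) ⟩
      C * (N 1 0 * detℕ n2 A₂) + C * Σℕ n2 (λ s → laplaceTerm n2 B₂ (suc s))
        ≈⟨ trans (sym (distribˡ C _ _)) (*-cong refl (+-cong (sym (*-identityˡ _)) refl)) ⟩
      C * detℕ (suc n2) B₂ ∎
      where
      D = minor N (suc j)
      C = detℕ n1 (minor B₁ j)

      firstColumn : detℕ n (minor D 0) ≈ C * detℕ n2 A₂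
      firstColumn = trans (detℕ-window n1 n2 0 (minor D 0) z≤n top bottom) (*-cong (*-identityˡ _) A₂-block)
        where
        top : TopRowsWithin n1 n 0 n1 (minor D 0)
        top r c r<n1 c<n (inj₂ n1≤c) =
          column-≡ (≡.cong suc (punchInℕ-≥ j c (≤-trans j≤n1 n1≤c)))
            (X₁-uX₂≈0 r (2 +ℕ c) r<n1 (s≤s (s≤s c<n)) (inj₂ (s≤s (s≤s n1≤c))))
        bottom : BottomRowsOff n1 n 0 n1 (minor D 0)
        bottom r c n1≤r r<n _ c<n1 =
          X₂-vX₁≈0 r _ n1≤r r<n (s≤s z≤n) (s≤s (s≤s (≤-trans (punchInℕ≤1+ j c) c<n1)))
        A₂-block : detℕ n2 (λ r c → minor D 0 (n1 +ℕ r) (n1 +ℕ c)) ≈ detℕ n2 A₂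
        A₂-block = detℕ-cong n2 λ r c _ _ →
          column-≡ (≡.cong suc (punchInℕ-≥ j (n1 +ℕ c) (≤-trans j≤n1 (m≤m+n n1 c)))) refl

      X₂-term : ∀ s → s < n2 → laplaceTerm n D (suc (n1 +ℕ s)) ≈ C * laplaceTerm n2 B₂ (suc s)
      X₂-term s s<n2 = begin
        sgnℕ (suc (n1 +ℕ s)) * (D 0 (suc (n1 +ℕ s)) * detℕ n M)
          ≈⟨ *-cong refl (*-cong entry (trans (detℕ-window n1 n2 1 M (≤-trans (s≤s z≤n) s<n2) top bottom)
                                              (*-cong (*-cong refl B₁-block) B₂-block))) ⟩
        sgnℕ (suc (n1 +ℕ s)) * (B₂ 0 (suc s) * (sgnℕ (1 *ℕ n1) * C * E))
          ≈⟨ solve 5 (λ x b y c e → x ⊕ (b ⊕ ((y ⊕ c) ⊕ e)) ⊜ c ⊕ ((x ⊕ y) ⊕ (b ⊕ e))) refl _ _ _ _ _ ⟩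
        C * (sgnℕ (suc (n1 +ℕ s)) * sgnℕ (1 *ℕ n1) * (B₂ 0 (suc s) * E))
          ≈⟨ *-cong refl (*-cong sign refl) ⟩
        C * laplaceTerm n2 B₂ (suc s) ∎
        where
        M = minor D (suc (n1 +ℕ s))
        E = detℕ n2 (minor B₂ (suc s))
        entry : D 0 (suc (n1 +ℕ s)) ≈ B₂ 0 (suc s)
        entry = column-≡ (≡.cong suc (punchInℕ-≥ j (n1 +ℕ s) (≤-trans j≤n1 (m≤m+n n1 s)))) refl
        sign : sgnℕ (suc (n1 +ℕ s)) * sgnℕ (1 *ℕ n1) ≈ sgnℕ (suc s)
        sign = trans (reflexive (≡.cong₂ (λ a b → sgnℕ a * sgnℕ b) (≡.sym (+-suc n1 s)) (*ℕ-identityˡ n1)))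
                     (sgnℕ-+-*-sgnℕ n1 (suc s))
        top : TopRowsWithin n1 n 1 (1 +ℕ n1) M
        top r zero    r<n1 _   _              = X₁-uX₂≈0 r 0 r<n1 (s≤s z≤n) (inj₁ ≡.refl)
        top r (suc c) r<n1 c<n (inj₁ (s≤s ()))
        top r (suc c) r<n1 c<n (inj₂ 1+n1≤c) =
          column-≡ (punchInℕ-≥ (suc j) y (≤-trans (s≤s j≤n1) y≥))
            (X₁-uX₂≈0 r (suc y) r<n1 (s≤s (s≤s (≤-trans (punchInℕ≤1+ (suc (n1 +ℕ s)) (suc c)) c<n)))
              (inj₂ (s≤s y≥)))
          where
          y = punchInℕ (suc (n1 +ℕ s)) (suc c)
          y≥ : suc n1 ≤ y
          y≥ = ≤-trans 1+n1≤c (≤punchInℕ (suc (n1 +ℕ s)) (suc c))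
        bottom : BottomRowsOff n1 n 1 (1 +ℕ n1) M
        bottom r c n1≤r r<n 1≤c c<1+n1 =
          column-≡ (≡.cong (punchInℕ (suc j))
                     (punchInℕ-< (suc (n1 +ℕ s)) c (≤-trans c<1+n1 (s≤s (m≤m+n n1 s)))))
            (X₂-vX₁≈0 r _ n1≤r r<n (≤-trans 1≤c (≤punchInℕ (suc j) c))
              (s≤s (≤-trans (punchInℕ≤1+ (suc j) c) c<1+n1)))
        B₁-block : detℕ n1 (λ r c → M r (1 +ℕ c)) ≈ C
        B₁-block = detℕ-cong n1 λ r c _ c<n1 →
          column-≡ (≡.cong (suc ∘ punchInℕ j) (punchInℕ-< (n1 +ℕ s) c (<-≤-trans c<n1 (m≤m+n n1 s)))) refl
        B₂-block : detℕ n2 (λ r c → M (n1 +ℕ r) (outside 1 n1 c)) ≈ E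
        B₂-block = detℕ-cong n2 λ where
          r zero    _ _ → refl
          r (suc c) _ _ → column-≡ (≡.cong suc (≡.trans (≡.cong (punchInℕ j) (punchInℕ-+ n1 s c))
                                                        (punchInℕ-≥ j _ (≤-trans j≤n1 (m≤m+n n1 _))))) refl

    detℕ-glued : detℕ (2 +ℕ n) N ≈
                 N 0 0 * N 1 1 * detℕ n1 A₁ * detℕ n2 A₂ + - (detℕ (suc n1) B₁ * detℕ (suc n2) B₂)
    detℕ-glued = begin
      laplaceTerm (suc n) N 0 + Σℕ (suc n) (λ j → laplaceTerm (suc n) N (suc j))
        ≈⟨ +-cong (trans (*-identityˡ _) (*-cong refl detℕ-minor₀))
                  (trans (Σℕ-split (suc n1) n2 (λ j → laplaceTerm (suc n) N (suc j)))
                         (+-cong (Σℕ-cong (suc n1) G₁-term) (Σℕ-zero n2 X₂-term≈0))) ⟩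
      N 0 0 * (N 1 1 * (detℕ n1 A₁ * detℕ n2 A₂)) + (Σℕ (suc n1) (λ j → laplaceTerm n1 B₁ j * - dB₂) + 0#)
        ≈⟨ +-cong (solve 4 (λ a b x y → a ⊕ (b ⊕ (x ⊕ y)) ⊜ ((a ⊕ b) ⊕ x) ⊕ y) refl _ _ _ _)
                  (trans (+-identityʳ _)
                         (trans (Σℕ-*ʳ (suc n1) (- dB₂) (laplaceTerm n1 B₁)) (sym (-‿distribʳ-* _ _)))) ⟩
      N 0 0 * N 1 1 * detℕ n1 A₁ * detℕ n2 A₂ + - (detℕ (suc n1) B₁ * dB₂) ∎
      where
      dB₂ = detℕ (suc n2) B₂
      G₁-term : ∀ j → j < suc n1 → laplaceTerm (suc n) N (suc j) ≈ laplaceTerm n1 B₁ j * - dB₂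
      G₁-term j (s≤s j≤n1) = begin
        - sgnℕ j * (N 0 (suc j) * detℕ (suc n) (minor N (suc j)))
          ≈⟨ *-cong refl (*-cong refl (detℕ-minorSuc j j≤n1)) ⟩
        - sgnℕ j * (N 0 (suc j) * (detℕ n1 (minor B₁ j) * dB₂))
          ≈⟨ -‿distribˡ-* _ _ ⟨
        - (sgnℕ j * (N 0 (suc j) * (detℕ n1 (minor B₁ j) * dB₂)))
          ≈⟨ -‿cong (solve 4 (λ x y z d → x ⊕ (y ⊕ (z ⊕ d)) ⊜ (x ⊕ (y ⊕ z)) ⊕ d) refl _ _ _ _) ⟩
        - (laplaceTerm n1 B₁ j * dB₂)
          ≈⟨ -‿distribʳ-* _ _ ⟩
        laplaceTerm n1 B₁ j * - dB₂ ∎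
      X₂-term≈0 : ∀ s → s < n2 → laplaceTerm (suc n) N (suc (suc n1 +ℕ s)) ≈ 0#
      X₂-term≈0 s s<n2 = laplaceTerm-zeroEntry (suc n) N _
        (u-X₂≈0 (2 +ℕ (n1 +ℕ s)) (s≤s (s≤s (m≤m+n n1 s))) (s≤s (s≤s (+-monoʳ-< n1 s<n2))))

-- The glued digraph

countℕ-cong : ∀ {n} {f g : Fin n → Bool} → (∀ i → f i ≡ g i) → countℕ f ≡ countℕ g
countℕ-cong {zero}  h = ≡.refl
countℕ-cong {suc n} h = ≡.cong₂ (λ b k → (if b then 1 else 0) +ℕ k) (h F.zero) (countℕ-cong (h ∘ F.suc))

countℕ-false : ∀ {n} {f : Fin n → Bool} → (∀ i → f i ≡ false) → countℕ f ≡ 0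
countℕ-false {zero}  h = ≡.refl
countℕ-false {suc n} h rewrite h F.zero = countℕ-false (h ∘ F.suc)

countℕ≡0⇒false : ∀ {n} (f : Fin n → Bool) → countℕ f ≡ 0 → ∀ i → f i ≡ false
countℕ≡0⇒false {suc n} f e i with f F.zero in f0
countℕ≡0⇒false {suc n} f e F.zero    | false = f0
countℕ≡0⇒false {suc n} f e (F.suc i) | false = countℕ≡0⇒false (f ∘ F.suc) e i

countℕ-↑ : ∀ m n (f : Fin (m +ℕ n) → Bool) →
           countℕ f ≡ countℕ (λ i → f (i ↑ˡ n)) +ℕ countℕ (λ j → f (m ↑ʳ j))
countℕ-↑ zero    n f = ≡.refl
countℕ-↑ (suc m) n f = ≡.trans (≡.cong (b +ℕ_) (countℕ-↑ m n (f ∘ F.suc))) (≡.sym (+ℕ-assoc b _ _))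
  where b = if f F.zero then 1 else 0

↑ˡ≢↑ʳ : ∀ {m n} (i : Fin m) (j : Fin n) → i ↑ˡ n ≢ m ↑ʳ j
↑ˡ≢↑ʳ {m} {n} i j eq
  with ≡.trans (≡.sym (splitAt-↑ˡ m i n)) (≡.trans (≡.cong (splitAt m) eq) (splitAt-↑ʳ m n j))
... | ()

liftAdj-rowFalse : ∀ {m} (f : Fin m → Fin m → Bool) i → (∀ j → f i j ≡ false) →
                   ∀ b → liftAdj f (just i) b ≡ false
liftAdj-rowFalse f i h (just j) = h j
liftAdj-rowFalse f i h nothing  = ≡.refl

module _ {c ℓ} (R : CommutativeRing c ℓ) (α x : CommutativeRing.Carrier R) where
  open CommutativeRing R hiding (zero)
  open import Algebra.Properties.Ring ring using (-0#≈0#)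

  Λ-cong : ∀ {m m′} (G : Digraph m) (G′ : Digraph m′) a b a′ b′ → does (a ≟ b) ≡ does (a′ ≟ b′) →
           outdeg G a ≡ outdeg G′ a′ → adj G a b ≡ adj G′ a′ b′ → Λ R α x G a b ≡ Λ R α x G′ a′ b′
  Λ-cong G G′ a b a′ b′ e₁ e₂ e₃ rewrite e₁ | e₂ | e₃ = ≡.refl

  Λ-offDiagonal≈0 : ∀ {m} (G : Digraph m) a b → does (a ≟ b) ≡ false → adj G a b ≡ false →
                    Λ R α x G a b ≈ 0#
  Λ-offDiagonal≈0 G a b e₁ e₃ rewrite e₁ | e₃ = trans (-‿cong (zeroʳ _)) -0#≈0#

module Gluing (n1 n2 : ℕ) where

  ι₁ : Fin (2 +ℕ n1) → Fin (2 +ℕ (n1 +ℕ n2))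
  ι₁ i = i ↑ˡ n2

  ι₂ : Fin (2 +ℕ n2) → Fin (2 +ℕ (n1 +ℕ n2))
  ι₂ 0F                = 0F
  ι₂ 1F                = 1F
  ι₂ (F.suc (F.suc s)) = F.suc (F.suc (n1 ↑ʳ s))

  x₁ : Fin n1 → Fin (2 +ℕ (n1 +ℕ n2))
  x₁ t = ι₁ (F.suc (F.suc t))

  x₂ : Fin n2 → Fin (2 +ℕ (n1 +ℕ n2))
  x₂ s = ι₂ (F.suc (F.suc s))

  toℕ-ι₁ : ∀ i → toℕ (ι₁ i) ≡ toℕ i
  toℕ-ι₁ i = toℕ-↑ˡ i n2

  toℕ-ι₂ : ∀ i → toℕ (ι₂ i) ≡ outside 2 n1 (toℕ i)
  toℕ-ι₂ 0F                = ≡.refl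
  toℕ-ι₂ 1F                = ≡.refl
  toℕ-ι₂ (F.suc (F.suc s)) = ≡.cong (suc ∘ suc) (toℕ-↑ʳ n1 s)

  ι₂-injective : ∀ {i j} → ι₂ i ≡ ι₂ j → i ≡ j
  ι₂-injective {0F}              {0F}              _  = ≡.refl
  ι₂-injective {1F}              {1F}              _  = ≡.refl
  ι₂-injective {F.suc (F.suc s)} {F.suc (F.suc s′)} eq =
    ≡.cong (F.suc ∘ F.suc) (↑ʳ-injective n1 s s′ (suc-injective (suc-injective eq)))
  ι₂-injective {0F}              {1F}              ()
  ι₂-injective {0F}              {F.suc (F.suc _)} ()
  ι₂-injective {1F}              {0F}              ()
  ι₂-injective {1F}              {F.suc (F.suc _)} ()
  ι₂-injective {F.suc (F.suc _)} {0F}              ()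
  ι₂-injective {F.suc (F.suc _)} {1F}              ()

  does-ι₁ : ∀ i j → does (ι₁ i ≟ ι₁ j) ≡ does (i ≟ j)
  does-ι₁ i j = does-⇔ (mk⇔ (↑ˡ-injective n2 i j) (≡.cong ι₁)) (ι₁ i ≟ ι₁ j) (i ≟ j)

  does-ι₂ : ∀ i j → does (ι₂ i ≟ ι₂ j) ≡ does (i ≟ j)
  does-ι₂ i j = does-⇔ (mk⇔ ι₂-injective (≡.cong ι₂)) (ι₂ i ≟ ι₂ j) (i ≟ j)

  in1-ι₁ : ∀ i → in1 {n1} {n2} (ι₁ i) ≡ just i
  in1-ι₁ 0F                = ≡.refl
  in1-ι₁ 1F                = ≡.refl
  in1-ι₁ (F.suc (F.suc t)) rewrite splitAt-↑ˡ n1 t n2 = ≡.refl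

  in2-ι₂ : ∀ i → in2 {n1} {n2} (ι₂ i) ≡ just i
  in2-ι₂ 0F                = ≡.refl
  in2-ι₂ 1F                = ≡.refl
  in2-ι₂ (F.suc (F.suc s)) rewrite splitAt-↑ʳ n1 n2 s = ≡.refl

  in2-x₁ : ∀ t → in2 {n1} {n2} (x₁ t) ≡ nothing
  in2-x₁ t rewrite splitAt-↑ˡ n1 t n2 = ≡.refl

  in1-x₂ : ∀ s → in1 {n1} {n2} (x₂ s) ≡ nothing
  in1-x₂ s rewrite splitAt-↑ʳ n1 n2 s = ≡.refl

  countℕ-ι₁ : (f : Fin (2 +ℕ (n1 +ℕ n2)) → Bool) → (∀ s → f (x₂ s) ≡ false) → countℕ f ≡ countℕ (f ∘ ι₁)
  countℕ-ι₁ f h = ≡.trans (countℕ-↑ (2 +ℕ n1) n2 f)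
    (≡.trans (≡.cong (countℕ (f ∘ ι₁) +ℕ_) (countℕ-false h)) (+ℕ-identityʳ _))

  countℕ-ι₂ : (f : Fin (2 +ℕ (n1 +ℕ n2)) → Bool) → (∀ t → f (x₁ t) ≡ false) → countℕ f ≡ countℕ (f ∘ ι₂)
  countℕ-ι₂ f h = ≡.cong (λ k → bit (f 0F) +ℕ (bit (f 1F) +ℕ k))
    (≡.trans (countℕ-↑ n1 n2 (f ∘ F.suc ∘ F.suc)) (≡.cong (_+ℕ countℕ (f ∘ x₂)) (countℕ-false h)))
    where
    bit : Bool → ℕ
    bit b = if b then 1 else 0

  module _ {c ℓ} (R : CommutativeRing c ℓ) where
    open CommutativeRing R hiding (zero)
    open Determinant R
    open import Relation.Binary.Reasoning.Setoid setoid

    det-glued : (M : Fin (2 +ℕ (n1 +ℕ n2)) → Fin (2 +ℕ (n1 +ℕ n2)) → Carrier) →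
      (∀ s → M 0F (x₂ s) ≈ 0#) → (∀ t → M 1F (x₁ t) ≈ 0#) → (∀ t → M (x₁ t) 0F ≈ 0#) →
      (∀ t s → M (x₁ t) (x₂ s) ≈ 0#) → (∀ s → M (x₂ s) 1F ≈ 0#) → (∀ s t → M (x₂ s) (x₁ t) ≈ 0#) →
      det R M ≈ M 0F 0F * M 1F 1F * det R (λ i j → M (x₁ i) (x₁ j)) * det R (λ i j → M (x₂ i) (x₂ j))
                + - (det R (λ i j → M (ι₁ (punchIn 1F i)) (ι₁ (F.suc j)))
                     * det R (λ i j → M (ι₂ (F.suc i)) (ι₂ (punchIn 1F j))))
    det-glued M u-x₂ v-x₁ x₁-u x₁-x₂ x₂-v x₂-x₁ = begin
      det R M
        ≈⟨ det≈detℕ M N (λ i j → reflexive (≡.sym (toMatrix-toℕ M i j))) ⟩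
      detℕ (2 +ℕ (n1 +ℕ n2)) N
        ≈⟨ G.detℕ-glued ⟩
      N 0 0 * N 1 1 * detℕ n1 G.A₁ * detℕ n2 G.A₂ + - (detℕ (suc n1) G.B₁ * detℕ (suc n2) G.B₂)
        ≈⟨ +-cong (*-cong (*-cong refl A₁≈) A₂≈) (-‿cong (*-cong B₁≈ B₂≈)) ⟨
      M 0F 0F * M 1F 1F * det R (λ i j → M (x₁ i) (x₁ j)) * det R (λ i j → M (x₂ i) (x₂ j))
        + - (det R (λ i j → M (ι₁ (punchIn 1F i)) (ι₁ (F.suc j)))
             * det R (λ i j → M (ι₂ (F.suc i)) (ι₂ (punchIn 1F j)))) ∎
      where
      N = toMatrix M

      entry≈0 : ∀ {a b r c} → toℕ a ≡ r → toℕ b ≡ c → M a b ≈ 0# → N r c ≈ 0#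
      entry≈0 {a} {b} ≡.refl ≡.refl z = trans (reflexive (toMatrix-toℕ M a b)) z

      toℕ-x₁ : ∀ {t} (t<n1 : t < n1) → toℕ (x₁ (fromℕ< t<n1)) ≡ 2 +ℕ t
      toℕ-x₁ t<n1 = ≡.trans (toℕ-ι₁ (F.suc (F.suc (fromℕ< t<n1)))) (≡.cong (2 +ℕ_) (toℕ-fromℕ< t<n1))

      toℕ-x₂ : ∀ {s} (s<n2 : s < n2) → toℕ (x₂ (fromℕ< s<n2)) ≡ 2 +ℕ (n1 +ℕ s)
      toℕ-x₂ s<n2 = ≡.trans (toℕ-ι₂ (F.suc (F.suc (fromℕ< s<n2))))
                            (≡.cong (λ s → 2 +ℕ (n1 +ℕ s)) (toℕ-fromℕ< s<n2))

      module G = GluedMatrix n1 n2 N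
        (λ s s<n2 → entry≈0 ≡.refl (toℕ-x₂ s<n2) (u-x₂ _))
        (λ t t<n1 → entry≈0 ≡.refl (toℕ-x₁ t<n1) (v-x₁ _))
        (λ t t<n1 → entry≈0 (toℕ-x₁ t<n1) ≡.refl (x₁-u _))
        (λ t s t<n1 s<n2 → entry≈0 (toℕ-x₁ t<n1) (toℕ-x₂ s<n2) (x₁-x₂ _ _))
        (λ s s<n2 → entry≈0 (toℕ-x₂ s<n2) ≡.refl (x₂-v _))
        (λ s t s<n2 t<n1 → entry≈0 (toℕ-x₂ s<n2) (toℕ-x₁ t<n1) (x₂-x₁ _ _))

      A₁≈ = det≈detℕ-toMatrix M x₁ x₁ (2 +ℕ_) (2 +ℕ_) (toℕ-ι₁ ∘ F.suc ∘ F.suc) (toℕ-ι₁ ∘ F.suc ∘ F.suc)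
      A₂≈ = det≈detℕ-toMatrix M x₂ x₂ (λ r → 2 +ℕ (n1 +ℕ r)) (λ c → 2 +ℕ (n1 +ℕ c))
              (toℕ-ι₂ ∘ F.suc ∘ F.suc) (toℕ-ι₂ ∘ F.suc ∘ F.suc)
      B₁≈ = det≈detℕ-toMatrix M (ι₁ ∘ punchIn 1F) (ι₁ ∘ F.suc) (punchInℕ 1) suc
              (λ i → ≡.trans (toℕ-ι₁ _) (toℕ-punchIn 1F i)) (toℕ-ι₁ ∘ F.suc)
      B₂≈ = det≈detℕ-toMatrix M (ι₂ ∘ F.suc) (ι₂ ∘ punchIn 1F)
              (outside 2 n1 ∘ suc) (outside 2 n1 ∘ punchInℕ 1)
              (toℕ-ι₂ ∘ F.suc) (λ j → ≡.trans (toℕ-ι₂ _) (≡.cong (outside 2 n1) (toℕ-punchIn 1F j)))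

  module GluedGraph (G1 : Digraph (2 +ℕ n1)) (G2 : Digraph (2 +ℕ n2))
    (u₁-in  : ∀ i → adj G1 i 0F ≡ false) (v₁-out : ∀ j → adj G1 1F j ≡ false)
    (u₂-out : ∀ j → adj G2 0F j ≡ false) (v₂-in  : ∀ i → adj G2 i 1F ≡ false) where

    H : Digraph (2 +ℕ (n1 +ℕ n2))
    H = glue G1 G2

    adj-u-x₂ : ∀ s → adj H 0F (x₂ s) ≡ false
    adj-u-x₂ s rewrite in1-x₂ s | in2-ι₂ (F.suc (F.suc s)) = u₂-out _

    adj-v-x₁ : ∀ t → adj H 1F (x₁ t) ≡ false
    adj-v-x₁ t rewrite in1-ι₁ (F.suc (F.suc t)) | in2-x₁ t | v₁-out (F.suc (F.suc t)) = ≡.refl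

    adj-x₁-u : ∀ t → adj H (x₁ t) 0F ≡ false
    adj-x₁-u t rewrite in1-ι₁ (F.suc (F.suc t)) | in2-x₁ t | u₁-in (F.suc (F.suc t)) = ≡.refl

    adj-x₁-x₂ : ∀ t s → adj H (x₁ t) (x₂ s) ≡ false
    adj-x₁-x₂ t s rewrite in1-ι₁ (F.suc (F.suc t)) | in1-x₂ s | in2-x₁ t = ≡.refl

    adj-x₂-v : ∀ s → adj H (x₂ s) 1F ≡ false
    adj-x₂-v s rewrite in1-x₂ s | in2-ι₂ (F.suc (F.suc s)) = v₂-in _

    adj-x₂-x₁ : ∀ s t → adj H (x₂ s) (x₁ t) ≡ false
    adj-x₂-x₁ s t rewrite in1-x₂ s | in2-ι₂ (F.suc (F.suc s)) | in2-x₁ t = ≡.refl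

    G₂-arcs-ι₁ : ∀ i b → liftAdj (adj G2) (in2 {n1} {n2} (ι₁ (punchIn 1F i))) b ≡ false
    G₂-arcs-ι₁ 0F          = liftAdj-rowFalse (adj G2) 0F u₂-out
    G₂-arcs-ι₁ (F.suc t) b rewrite in2-x₁ t = ≡.refl

    G₁-arcs-ι₂ : ∀ i b → liftAdj (adj G1) (in1 {n1} {n2} (ι₂ (F.suc i))) b ≡ false
    G₁-arcs-ι₂ 0F          = liftAdj-rowFalse (adj G1) 1F v₁-out
    G₁-arcs-ι₂ (F.suc s) b rewrite in1-x₂ s = ≡.refl

    adj-ι₁ : ∀ i j → adj H (ι₁ (punchIn 1F i)) (ι₁ j) ≡ adj G1 (punchIn 1F i) j
    adj-ι₁ i j rewrite in1-ι₁ (punchIn 1F i) | in1-ι₁ j | G₂-arcs-ι₁ i (in2 {n1} {n2} (ι₁ j)) =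
      ∨-identityʳ _

    adj-ι₂ : ∀ i j → adj H (ι₂ (F.suc i)) (ι₂ j) ≡ adj G2 (F.suc i) j
    adj-ι₂ i j rewrite in2-ι₂ (F.suc i) | in2-ι₂ j | G₁-arcs-ι₂ i (in1 {n1} {n2} (ι₂ j)) = ≡.refl

    outdeg-ι₁ : ∀ i → outdeg H (ι₁ (punchIn 1F i)) ≡ outdeg G1 (punchIn 1F i)
    outdeg-ι₁ i =
      ≡.trans (countℕ-ι₁ (adj H (ι₁ (punchIn 1F i))) (X₂-column i)) (countℕ-cong (adj-ι₁ i))
      where
      X₂-column : ∀ i s → adj H (ι₁ (punchIn 1F i)) (x₂ s) ≡ false
      X₂-column 0F        = adj-u-x₂
      X₂-column (F.suc t) = adj-x₁-x₂ t

    outdeg-ι₂ : ∀ i → outdeg H (ι₂ (F.suc i)) ≡ outdeg G2 (F.suc i)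
    outdeg-ι₂ i =
      ≡.trans (countℕ-ι₂ (adj H (ι₂ (F.suc i))) (X₁-column i)) (countℕ-cong (adj-ι₂ i))
      where
      X₁-column : ∀ i t → adj H (ι₂ (F.suc i)) (x₁ t) ≡ false
      X₁-column 0F        = adj-v-x₁
      X₁-column (F.suc s) = adj-x₂-x₁ s

    module ΛEntries {c ℓ} (R : CommutativeRing c ℓ) (α x : CommutativeRing.Carrier R) where
      open CommutativeRing R using (_≈_; 0#)

      Λ-ι₁ : ∀ i j → Λ R α x H (ι₁ (punchIn 1F i)) (ι₁ j) ≡ Λ R α x G1 (punchIn 1F i) j
      Λ-ι₁ i j = Λ-cong R α x H G1 (ι₁ (punchIn 1F i)) (ι₁ j) (punchIn 1F i) j
                   (does-ι₁ (punchIn 1F i) j) (outdeg-ι₁ i) (adj-ι₁ i j)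

      Λ-ι₂ : ∀ i j → Λ R α x H (ι₂ (F.suc i)) (ι₂ j) ≡ Λ R α x G2 (F.suc i) j
      Λ-ι₂ i j = Λ-cong R α x H G2 (ι₂ (F.suc i)) (ι₂ j) (F.suc i) j
                   (does-ι₂ (F.suc i) j) (outdeg-ι₂ i) (adj-ι₂ i j)

      Λ-u-x₂ : ∀ s → Λ R α x H 0F (x₂ s) ≈ 0#
      Λ-u-x₂ s = Λ-offDiagonal≈0 R α x H 0F (x₂ s) ≡.refl (adj-u-x₂ s)

      Λ-v-x₁ : ∀ t → Λ R α x H 1F (x₁ t) ≈ 0#
      Λ-v-x₁ t = Λ-offDiagonal≈0 R α x H 1F (x₁ t) ≡.refl (adj-v-x₁ t)

      Λ-x₁-u : ∀ t → Λ R α x H (x₁ t) 0F ≈ 0#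
      Λ-x₁-u t = Λ-offDiagonal≈0 R α x H (x₁ t) 0F ≡.refl (adj-x₁-u t)

      Λ-x₁-x₂ : ∀ t s → Λ R α x H (x₁ t) (x₂ s) ≈ 0#
      Λ-x₁-x₂ t s =
        Λ-offDiagonal≈0 R α x H (x₁ t) (x₂ s) (dec-false (_ ≟ _) (↑ˡ≢↑ʳ t s)) (adj-x₁-x₂ t s)

      Λ-x₂-v : ∀ s → Λ R α x H (x₂ s) 1F ≈ 0#
      Λ-x₂-v s = Λ-offDiagonal≈0 R α x H (x₂ s) 1F ≡.refl (adj-x₂-v s)

      Λ-x₂-x₁ : ∀ s t → Λ R α x H (x₂ s) (x₁ t) ≈ 0#
      Λ-x₂-x₁ s t =
        Λ-offDiagonal≈0 R α x H (x₂ s) (x₁ t) (dec-false (_ ≟ _) (↑ˡ≢↑ʳ t s ∘ ≡.sym)) (adj-x₂-x₁ s t)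

lemma4p1 : ∀ {c ℓ} (R : CommutativeRing c ℓ) (α x : CommutativeRing.Carrier R)
    (n1 n2 : ℕ) (G1 : Digraph (2 N.+ n1)) (G2 : Digraph (2 N.+ n2)) →
    indeg G1 F.zero ≡ 0 → outdeg G1 (F.suc F.zero) ≡ 0 →
    outdeg G2 F.zero ≡ 0 → indeg G2 (F.suc F.zero) ≡ 0 →
    let open CommutativeRing R in
    φ R α x (glue G1 G2)
      ≈ (x + - (α * fromℕ R (outdeg G1 F.zero))) * (x + - (α * fromℕ R (outdeg G2 (F.suc F.zero))))
          * det R (del01 R (Λ R α x G1)) * det R (del01 R (Λ R α x G2))
        + - (det R (del R (Λ R α x G1) (F.suc F.zero) F.zero)
             * det R (del R (Λ R α x G2) F.zero (F.suc F.zero)))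
lemma4p1 R α x n1 n2 G1 G2 u₁-in v₁-out u₂-out v₂-in =
  trans (det-glued R (Λ R α x H) Λ-u-x₂ Λ-v-x₁ Λ-x₁-u Λ-x₁-x₂ Λ-x₂-v Λ-x₂-x₁)
    (+-cong (*-cong (*-cong (*-cong (reflexive (Λ-ι₁ 0F 0F)) (reflexive (Λ-ι₂ 0F 1F)))
                            (det-cong (λ i j → reflexive (Λ-ι₁ (F.suc i) (F.suc (F.suc j))))))
                    (det-cong (λ i j → reflexive (Λ-ι₂ (F.suc i) (F.suc (F.suc j))))))
            (-‿cong (*-cong (det-cong (λ i j → reflexive (Λ-ι₁ i (F.suc j))))
                            (det-cong (λ i j → reflexive (Λ-ι₂ i (punchIn 1F j)))))))
  where
  open CommutativeRing R
  open Determinant R using (det-cong)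
  open Gluing n1 n2
  open GluedGraph G1 G2 (countℕ≡0⇒false _ u₁-in) (countℕ≡0⇒false _ v₁-out)
                        (countℕ≡0⇒false _ u₂-out) (countℕ≡0⇒false _ v₂-in)
  open ΛEntries R α x
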